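{- For every integer $n\ge 1$, the number of non-isomorphic MinD trees with $n$ leaves is exactly $(2\omega(n)-3)!!$, where $\omega(n)$ is the number of $1$s in the binary expansion of $n$ (with the convention $(-1)!!=1$).
   Context: A full binary tree is a rooted tree in which every node has $0$ or $2$ children; trees are counted up to isomorphism (swapping children of nodes), leaves unlabeled. An internal node is an $S$-node if its two children have the same number of descendant leaves, and a $D$-node otherwise. A MinD tree on $n$ leaves is a full binary tree with $n$ leaves having the minimum number of $D$-nodes among all full binary trees with $n$ leaves. -}

module Defs where

open import Data.Nat using (ℕ; zero; suc; _+_; _*_; _∸_; _≤_; _≡ᵇ_; _%_; _/_)
open import Data.Bool using (if_then_else_)
open import Data.List using (List; length)
open import Data.List.Relation.Unary.All using (All)
open import Data.List.Relation.Unary.Any using (Any)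
open import Data.List.Relation.Unary.AllPairs using (AllPairs)
open import Data.Product using (_×_; Σ)
open import Relation.Nullary using (¬_)
open import Relation.Binary.PropositionalEquality using (_≡_)

data Tree : Set where
  leaf : Tree
  node : Tree → Tree → Tree

leaves : Tree → ℕ
leaves leaf       = 1
leaves (node l r) = leaves l + leaves r

dnodes : Tree → ℕ
dnodes leaf       = 0
dnodes (node l r) = dnodes l + dnodes r + (if leaves l ≡ᵇ leaves r then 0 else 1)

data _≅_ : Tree → Tree → Set where
  leaf≅ : leaf ≅ leaf
  keep≅ : ∀ {l r l′ r′} → l ≅ l′ → r ≅ r′ → node l r ≅ node l′ r′
  swap≅ : ∀ {l r l′ r′} → l ≅ r′ → r ≅ l′ → node l r ≅ node l′ r′

IsMinD : ℕ → Tree → Set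
IsMinD n t = leaves t ≡ n × (∀ t′ → leaves t′ ≡ n → dnodes t ≤ dnodes t′)

-- "there are exactly k isomorphism classes of trees satisfying P":
-- a list of k representatives satisfying P, pairwise non-isomorphic,
-- such that every tree satisfying P is isomorphic to one of them.
NumClasses : (Tree → Set) → ℕ → Set
NumClasses P k =
  Σ (List Tree) λ reps →
    length reps ≡ k ×
    All P reps ×
    AllPairs (λ s t → ¬ (s ≅ t)) reps ×
    (∀ t → P t → Any (λ s → t ≅ s) reps)

-- ω(n): number of 1s in the binary expansion of n (fuel-based; fuel n suffices)
popcount′ : ℕ → ℕ → ℕ
popcount′ zero    _ = 0
popcount′ (suc f) n = n % 2 + popcount′ f (n / 2)

ω : ℕ → ℕ
ω n = popcount′ n n

_!! : ℕ → ℕ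
zero !!          = 1
suc zero !!      = 1
suc (suc m) !!   = suc (suc m) * (m !!)

-- (2w - 3)!! with the convention (-1)!! = 1 (the case w = 1);
-- only used for w ≥ 1
dfact2w-3 : ℕ → ℕ
dfact2w-3 zero          = 1
dfact2w-3 (suc zero)    = 1
dfact2w-3 (suc (suc w)) = (2 * suc (suc w) ∸ 3) !!

module Submission where

-- We have ω (m + m) = ω m and ω (a + b) ≤ ω a + ω b, with equality iff adding a and b in binary
-- produces no carry. By induction, a tree with n leaves therefore has at least ω n - 1 D-nodes, with
-- equality (the tree is tight) iff the children of each S-node are perfect and the leaf counts of
-- the children of each D-node add without carry; since tight trees exist, the MinD trees are the
-- tight ones. Canonical tight trees are generated along the binary expansion of n: from those
-- for m, double every leaf to get 2m leaves, and to get 2m + 1 also graft one new leaf, which a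
-- tree with d = ω m - 1 D-nodes admits in 2d + 1 = 2 ω m - 1 ways. This gives (2 ω n - 3)!!
-- pairwise distinct canonical trees, and every tight tree is isomorphic to one of them.

open import Defs
open import Data.Nat
open import Data.Nat.Properties
open import Data.Nat.DivMod
open import Data.Nat.Induction using (<-rec)
open import Relation.Binary.PropositionalEquality
open import Relation.Binary.Definitions using (tri<; tri≈; tri>)
open import Function using (_∘_)
open import Data.Nat.Solver using (module +-*-Solver)
open +-*-Solver using (solve; _:+_; _:*_; _:=_; con)
open import Data.Nat.Divisibility using (divides-refl)
open import Algebra.Properties.CommutativeSemigroup +-commutativeSemigroup using (interchange)
open import Relation.Nullary using (¬_; yes; no; contradiction)
open import Relation.Nullary.Decidable using (dec-true; dec-false)
open import Data.Parity.Base using (Parity; 0ℙ; 1ℙ)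
open import Data.Product using (_×_; _,_; proj₁; proj₂; ∃)
open import Data.Sum using (inj₁; inj₂)
open import Data.List using (List; []; _∷_; map; _++_; concatMap; length)
open import Data.List.Properties using (length-++; length-map)
open import Data.List.Membership.Propositional using (_∈_; find; lose)
import Data.List.Relation.Unary.Any.Properties as Any
open import Data.List.Membership.Propositional.Properties
  using (∈-++⁻; ∈-++⁺ˡ; ∈-++⁺ʳ; ∈-map⁻; ∈-map⁺)
open import Data.List.Relation.Unary.Any using (Any; here; there)
open import Data.List.Relation.Unary.All as All using (All; []; _∷_)
import Data.List.Relation.Unary.All.Properties as All
open import Data.List.Relation.Unary.AllPairs using (AllPairs; []; _∷_)
import Data.List.Relation.Unary.AllPairs as AllPairs
import Data.List.Relation.Unary.AllPairs.Properties as AllPairs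
open import Data.List.Relation.Binary.Disjoint.Propositional using (Disjoint)
open import Data.List.Relation.Unary.Unique.Propositional using (Unique)
import Data.List.Relation.Unary.Unique.Propositional.Properties as Unique

-- Binary arithmetic

data Halving : ℕ → Set where
  even : ∀ m → Halving (m + m)
  odd  : ∀ m → Halving (suc (m + m))

halving : ∀ n → Halving n
halving zero = even zero
halving (suc n) with halving n
... | even m = odd m
... | odd m  = subst Halving (cong suc (+-suc m m)) (even (suc m))

binary-ind : (P : ℕ → Set) → P 0 →
             (∀ m → P m → P (m + m)) → (∀ m → P m → P (suc (m + m))) → ∀ n → P n
binary-ind P p₀ pₑ pₒ = <-rec P step
  where
  step : ∀ n → (∀ {m} → m < n → P m) → P n
  step n rec with halving n
  ... | even zero    = p₀
  ... | even (suc m) = pₑ (suc m) (rec (m<m+n (suc m) z<s))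
  ... | odd m        = pₒ m (rec (s≤s (m≤m+n m m)))

parity-even : ∀ m → parity (m + m) ≡ 0ℙ
parity-even zero    = refl
parity-even (suc m) = trans (cong (parity ∘ suc) (+-suc m m)) (parity-even m)

parity-odd : ∀ m → parity (suc (m + m)) ≡ 1ℙ
parity-odd zero    = refl
parity-odd (suc m) = trans (cong (parity ∘ suc ∘ suc) (+-suc m m)) (parity-odd m)

odd≢even : ∀ m n → suc (m + m) ≢ n + n
odd≢even m n eq with trans (sym (parity-odd m)) (trans (cong parity eq) (parity-even n))
... | ()

double-+ : ∀ x y → (x + x) + (y + y) ≡ (x + y) + (x + y)
double-+ x y = interchange x x y y

double-cancel : ∀ {m n} → m + m ≡ n + n → m ≡ n
double-cancel {m} {n} eq = trans (n≡⌊n+n/2⌋ m) (trans (cong ⌊_/2⌋ eq) (sym (n≡⌊n+n/2⌋ n)))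

double-<⁻ : ∀ {m n} → m + m < n + n → m < n
double-<⁻ {m} {n} 2m<2n with m <? n
... | yes m<n = m<n
... | no  m≮n = contradiction 2m<2n (≤⇒≯ (+-mono-≤ (≮⇒≥ m≮n) (≮⇒≥ m≮n)))

double-≤⁻ : ∀ {m n} → m + m ≤ n + n → m ≤ n
double-≤⁻ {m} {n} 2m≤2n with m ≤? n
... | yes m≤n = m≤n
... | no  m≰n = contradiction 2m≤2n (<⇒≱ (+-mono-< (≰⇒> m≰n) (≰⇒> m≰n)))

m+n≤m⇒n≡0 : ∀ m {n} → m + n ≤ m → n ≡ 0
m+n≤m⇒n≡0 m {n} m+n≤m =
  n≤0⇒n≡0 (+-cancelˡ-≤ m n 0 (subst (m + n ≤_) (sym (+-identityʳ m)) m+n≤m))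

+-≤-squeeze : ∀ {p q P Q} → p ≤ P → q ≤ Q → P + Q ≤ p + q → p ≡ P × q ≡ Q
+-≤-squeeze {p} {q} {P} {Q} p≤P q≤Q P+Q≤p+q =
  ≤-antisym p≤P (+-cancelʳ-≤ Q P p (≤-trans P+Q≤p+q (+-monoʳ-≤ p q≤Q))) ,
  ≤-antisym q≤Q (+-cancelˡ-≤ P Q q (≤-trans P+Q≤p+q (+-monoˡ-≤ q p≤P)))

-- The binary weight ω

m≤1+n⇒m/2≤n : ∀ {m n} → m ≤ suc n → m / 2 ≤ n
m≤1+n⇒m/2≤n {zero}  _ = z≤n
m≤1+n⇒m/2≤n {suc m} m≤1+n = ≤-pred (≤-trans (m/n<m (suc m) 2 (s≤s (s≤s z≤n))) m≤1+n)

popcount′-fuel : ∀ f g n → n ≤ f → n ≤ g → popcount′ f n ≡ popcount′ g n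
popcount′-fuel zero    zero    _ _ _ = refl
popcount′-fuel zero    (suc g) _ z≤n _ = popcount′-fuel zero g 0 z≤n z≤n
popcount′-fuel (suc f) zero    _ _ z≤n = popcount′-fuel f zero 0 z≤n z≤n
popcount′-fuel (suc f) (suc g) n n≤f n≤g =
  cong (n % 2 +_) (popcount′-fuel f g (n / 2) (m≤1+n⇒m/2≤n n≤f) (m≤1+n⇒m/2≤n n≤g))

ω-suc : ∀ n → ω (suc n) ≡ suc n % 2 + ω (suc n / 2)
ω-suc n = cong (suc n % 2 +_)
  (popcount′-fuel n (suc n / 2) (suc n / 2) (m≤1+n⇒m/2≤n ≤-refl) ≤-refl)

m+m≡m*2 : ∀ m → m + m ≡ m * 2
m+m≡m*2 = solve 1 (λ m → m :+ m := m :* con 2) refl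

[b+2m]%2≡b : ∀ b m → b < 2 → (b + (m + m)) % 2 ≡ b
[b+2m]%2≡b b m b<2 rewrite m+m≡m*2 m = trans ([m+kn]%n≡m%n b m 2) (m<n⇒m%n≡m b<2)

[b+2m]/2≡m : ∀ b m → b < 2 → (b + (m + m)) / 2 ≡ m
[b+2m]/2≡m b m b<2 rewrite m+m≡m*2 m =
  trans (+-distrib-/-∣ʳ b (divides-refl m)) (cong₂ _+_ (m<n⇒m/n≡0 b<2) (m*n/n≡m m 2))

ω-even : ∀ m → ω (m + m) ≡ ω m
ω-even zero    = refl
ω-even (suc m) = begin
  ω (suc m + suc m)
    ≡⟨ ω-suc (m + suc m) ⟩
  (suc m + suc m) % 2 + ω ((suc m + suc m) / 2)
    ≡⟨ cong₂ (λ b h → b + ω h) ([b+2m]%2≡b 0 (suc m) z<s) ([b+2m]/2≡m 0 (suc m) z<s) ⟩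
  ω (suc m) ∎
  where open ≡-Reasoning

ω-odd : ∀ m → ω (suc (m + m)) ≡ suc (ω m)
ω-odd m = begin
  ω (suc (m + m))
    ≡⟨ ω-suc (m + m) ⟩
  suc (m + m) % 2 + ω (suc (m + m) / 2)
    ≡⟨ cong₂ (λ b h → b + ω h) ([b+2m]%2≡b 1 m (s<s z<s)) ([b+2m]/2≡m 1 m (s<s z<s)) ⟩
  suc (ω m) ∎
  where open ≡-Reasoning

ω-positive : ∀ n → 1 ≤ n → 1 ≤ ω n
ω-positive = binary-ind (λ n → 1 ≤ n → 1 ≤ ω n) (λ ()) even-case odd-case
  where
  even-case : ∀ m → (1 ≤ m → 1 ≤ ω m) → 1 ≤ m + m → 1 ≤ ω (m + m)
  even-case zero    _  ()
  even-case (suc m) ih _ = subst (1 ≤_) (sym (ω-even (suc m))) (ih (s≤s z≤n))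
  odd-case : ∀ m → (1 ≤ m → 1 ≤ ω m) → 1 ≤ suc (m + m) → 1 ≤ ω (suc (m + m))
  odd-case m _ _ = subst (1 ≤_) (sym (ω-odd m)) (s≤s z≤n)

ω-suc-≤ : ∀ n → ω (suc n) ≤ suc (ω n)
ω-suc-≤ = binary-ind (λ n → ω (suc n) ≤ suc (ω n)) ≤-refl even-case odd-case
  where
  even-case : ∀ m → ω (suc m) ≤ suc (ω m) → ω (suc (m + m)) ≤ suc (ω (m + m))
  even-case m _ = ≤-reflexive (trans (ω-odd m) (cong suc (sym (ω-even m))))
  odd-case : ∀ m → ω (suc m) ≤ suc (ω m) → ω (suc (suc (m + m))) ≤ suc (ω (suc (m + m)))
  odd-case m ih = begin
    ω (suc (suc (m + m)))   ≡⟨ cong ω (cong suc (sym (+-suc m m))) ⟩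
    ω (suc m + suc m)       ≡⟨ ω-even (suc m) ⟩
    ω (suc m)               ≤⟨ ih ⟩
    suc (ω m)               ≡⟨ sym (ω-odd m) ⟩
    ω (suc (m + m))         ≤⟨ n≤1+n _ ⟩
    suc (ω (suc (m + m)))   ∎
    where open ≤-Reasoning

ω-even+even : ∀ x y → ω ((x + x) + (y + y)) ≡ ω (x + y)
ω-even+even x y = trans (cong ω (double-+ x y)) (ω-even (x + y))

ω-odd+even : ∀ x y → ω (suc (x + x) + (y + y)) ≡ suc (ω (x + y))
ω-odd+even x y = trans (cong (ω ∘ suc) (double-+ x y)) (ω-odd (x + y))

ω-even+odd : ∀ x y → ω ((x + x) + suc (y + y)) ≡ suc (ω (x + y))
ω-even+odd x y = trans (cong ω (+-suc (x + x) (y + y))) (ω-odd+even x y)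

ω-odd+odd : ∀ x y → ω (suc (x + x) + suc (y + y)) ≡ ω (suc (x + y))
ω-odd+odd x y = begin
  ω (suc (x + x) + suc (y + y))     ≡⟨ cong (ω ∘ suc) (+-suc (x + x) (y + y)) ⟩
  ω (suc (suc ((x + x) + (y + y)))) ≡⟨ cong (ω ∘ suc ∘ suc) (double-+ x y) ⟩
  ω (suc (suc ((x + y) + (x + y)))) ≡⟨ cong (ω ∘ suc) (sym (+-suc (x + y) (x + y))) ⟩
  ω (suc (x + y) + suc (x + y))     ≡⟨ ω-even (suc (x + y)) ⟩
  ω (suc (x + y))                   ∎
  where open ≡-Reasoning

ω-+-≤ : ∀ a b → ω (a + b) ≤ ω a + ω b
ω-+-≤ = binary-ind Subadditive (λ _ → ≤-refl) even-case odd-case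
  where
  open ≤-Reasoning
  Subadditive : ℕ → Set
  Subadditive a = ∀ b → ω (a + b) ≤ ω a + ω b
  even-case : ∀ x → Subadditive x → Subadditive (x + x)
  even-case x ih b with halving b
  ... | even y = begin
    ω ((x + x) + (y + y))   ≡⟨ ω-even+even x y ⟩
    ω (x + y)               ≤⟨ ih y ⟩
    ω x + ω y               ≡⟨ sym (cong₂ _+_ (ω-even x) (ω-even y)) ⟩
    ω (x + x) + ω (y + y)   ∎
  ... | odd y = begin
    ω ((x + x) + suc (y + y))     ≡⟨ ω-even+odd x y ⟩
    suc (ω (x + y))               ≤⟨ s≤s (ih y) ⟩
    suc (ω x + ω y)               ≡⟨ sym (+-suc (ω x) (ω y)) ⟩
    ω x + suc (ω y)               ≡⟨ sym (cong₂ _+_ (ω-even x) (ω-odd y)) ⟩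
    ω (x + x) + ω (suc (y + y))   ∎
  odd-case : ∀ x → Subadditive x → Subadditive (suc (x + x))
  odd-case x ih b with halving b
  ... | even y = begin
    ω (suc (x + x) + (y + y))     ≡⟨ ω-odd+even x y ⟩
    suc (ω (x + y))               ≤⟨ s≤s (ih y) ⟩
    suc (ω x + ω y)               ≡⟨ sym (cong₂ _+_ (ω-odd x) (ω-even y)) ⟩
    ω (suc (x + x)) + ω (y + y)   ∎
  ... | odd y = begin
    ω (suc (x + x) + suc (y + y))       ≡⟨ ω-odd+odd x y ⟩
    ω (suc (x + y))                     ≤⟨ ω-suc-≤ (x + y) ⟩
    suc (ω (x + y))                     ≤⟨ s≤s (ih y) ⟩
    suc (ω x + ω y)                     ≤⟨ n≤1+n _ ⟩
    suc (suc (ω x + ω y))               ≡⟨ cong suc (sym (+-suc (ω x) (ω y))) ⟩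
    suc (ω x) + suc (ω y)               ≡⟨ sym (cong₂ _+_ (ω-odd x) (ω-odd y)) ⟩
    ω (suc (x + x)) + ω (suc (y + y))   ∎

-- Adding a and b in binary produces no carry.
CarryFree : ℕ → ℕ → Set
CarryFree a b = ω (a + b) ≡ ω a + ω b

carryFree-sym : ∀ {a b} → CarryFree a b → CarryFree b a
carryFree-sym {a} {b} cf = trans (cong ω (+-comm b a)) (trans cf (+-comm (ω a) (ω b)))

carryFree-even-even : ∀ {x y} → CarryFree (x + x) (y + y) → CarryFree x y
carryFree-even-even {x} {y} cf = begin
  ω (x + y)               ≡⟨ sym (ω-even+even x y) ⟩
  ω ((x + x) + (y + y))   ≡⟨ cf ⟩
  ω (x + x) + ω (y + y)   ≡⟨ cong₂ _+_ (ω-even x) (ω-even y) ⟩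
  ω x + ω y               ∎
  where open ≡-Reasoning

carryFree-odd-even : ∀ {x y} → CarryFree (suc (x + x)) (y + y) → CarryFree x y
carryFree-odd-even {x} {y} cf = suc-injective (begin
  suc (ω (x + y))                 ≡⟨ sym (ω-odd+even x y) ⟩
  ω (suc (x + x) + (y + y))       ≡⟨ cf ⟩
  ω (suc (x + x)) + ω (y + y)     ≡⟨ cong₂ _+_ (ω-odd x) (ω-even y) ⟩
  suc (ω x + ω y)                 ∎)
  where open ≡-Reasoning

carryFree-even-odd : ∀ {x y} → CarryFree (x + x) (suc (y + y)) → CarryFree x y
carryFree-even-odd {x} {y} cf =
  carryFree-sym {y} {x} (carryFree-odd-even {y} {x} (carryFree-sym {x + x} {suc (y + y)} cf))

¬carryFree-odd-odd : ∀ x y → ¬ CarryFree (suc (x + x)) (suc (y + y))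
¬carryFree-odd-odd x y cf = <-irrefl cf (begin-strict
  ω (suc (x + x) + suc (y + y))       ≡⟨ ω-odd+odd x y ⟩
  ω (suc (x + y))                     ≤⟨ ω-suc-≤ (x + y) ⟩
  suc (ω (x + y))                     ≤⟨ s≤s (ω-+-≤ x y) ⟩
  suc (ω x + ω y)                     <⟨ n<1+n _ ⟩
  suc (suc (ω x + ω y))               ≡⟨ cong suc (sym (+-suc (ω x) (ω y))) ⟩
  suc (ω x) + suc (ω y)               ≡⟨ sym (cong₂ _+_ (ω-odd x) (ω-odd y)) ⟩
  ω (suc (x + x)) + ω (suc (y + y))   ∎)
  where open ≤-Reasoning

¬carryFree-self : ∀ x → 1 ≤ x → ¬ CarryFree x x
¬carryFree-self x 1≤x cf = <⇒≢ (ω-positive x 1≤x)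
  (+-cancelˡ-≡ (ω x) 0 (ω x) (trans (+-identityʳ (ω x)) (trans (sym (ω-even x)) cf)))

-- Doubling and tight trees

leftChild rightChild : Tree → Tree
leftChild  leaf       = leaf
leftChild  (node l _) = l
rightChild leaf       = leaf
rightChild (node _ r) = r

1≤leaves : ∀ t → 1 ≤ leaves t
1≤leaves leaf       = s≤s z≤n
1≤leaves (node l r) = ≤-trans (1≤leaves l) (m≤m+n (leaves l) (leaves r))

dnodes-S : ∀ l r → leaves l ≡ leaves r → dnodes (node l r) ≡ dnodes l + dnodes r
dnodes-S l r eq rewrite dec-true (leaves l ≟ leaves r) eq = +-identityʳ _

dnodes-D : ∀ l r → leaves l ≢ leaves r → dnodes (node l r) ≡ suc (dnodes l + dnodes r)
dnodes-D l r neq rewrite dec-false (leaves l ≟ leaves r) neq = +-comm _ 1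

double : Tree → Tree
double leaf       = node leaf leaf
double (node l r) = node (double l) (double r)

leaves-double : ∀ t → leaves (double t) ≡ leaves t + leaves t
leaves-double leaf       = refl
leaves-double (node l r) = trans (cong₂ _+_ (leaves-double l) (leaves-double r))
                                 (interchange (leaves l) (leaves l) (leaves r) (leaves r))

dnodes-double : ∀ t → dnodes (double t) ≡ dnodes t
dnodes-double leaf = refl
dnodes-double (node l r) with leaves l ≟ leaves r
... | yes eq = begin
  dnodes (node (double l) (double r))   ≡⟨ dnodes-S (double l) (double r) (doubled eq) ⟩
  dnodes (double l) + dnodes (double r) ≡⟨ cong₂ _+_ (dnodes-double l) (dnodes-double r) ⟩
  dnodes l + dnodes r                   ≡⟨ sym (dnodes-S l r eq) ⟩
  dnodes (node l r)                     ∎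
  where
  open ≡-Reasoning
  doubled : leaves l ≡ leaves r → leaves (double l) ≡ leaves (double r)
  doubled eq = trans (leaves-double l) (trans (cong₂ _+_ eq eq) (sym (leaves-double r)))
... | no neq = begin
  dnodes (node (double l) (double r))         ≡⟨ dnodes-D (double l) (double r) (neq ∘ halved) ⟩
  suc (dnodes (double l) + dnodes (double r)) ≡⟨ cong suc (cong₂ _+_ (dnodes-double l) (dnodes-double r)) ⟩
  suc (dnodes l + dnodes r)                   ≡⟨ sym (dnodes-D l r neq) ⟩
  dnodes (node l r)                           ∎
  where
  open ≡-Reasoning
  halved : leaves (double l) ≡ leaves (double r) → leaves l ≡ leaves r
  halved eq = double-cancel (trans (sym (leaves-double l)) (trans eq (leaves-double r)))

double-injective : ∀ {s t} → double s ≡ double t → s ≡ t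
double-injective {leaf}     {leaf}     _  = refl
double-injective {leaf}     {node (node _ _) _} ()
double-injective {leaf}     {node leaf _} ()
double-injective {node (node _ _) _} {leaf} ()
double-injective {node leaf _} {leaf} ()
double-injective {node _ _} {node _ _} eq = cong₂ node (double-injective (cong leftChild eq))
                                                       (double-injective (cong rightChild eq))

double≢leaf : ∀ t → double t ≢ leaf
double≢leaf leaf       ()
double≢leaf (node _ _) ()

ω-leaves-≤ : ∀ t → ω (leaves t) ≤ suc (dnodes t)
ω-leaves-≤ leaf = ≤-refl
ω-leaves-≤ (node l r) with leaves l ≟ leaves r
... | yes eq = begin
  ω (leaves l + leaves r)     ≡⟨ cong (λ b → ω (leaves l + b)) (sym eq) ⟩
  ω (leaves l + leaves l)     ≡⟨ ω-even (leaves l) ⟩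
  ω (leaves l)                ≤⟨ ω-leaves-≤ l ⟩
  suc (dnodes l)              ≤⟨ s≤s (m≤m+n (dnodes l) (dnodes r)) ⟩
  suc (dnodes l + dnodes r)   ≡⟨ cong suc (sym (dnodes-S l r eq)) ⟩
  suc (dnodes (node l r))     ∎
  where open ≤-Reasoning
... | no neq = begin
  ω (leaves l + leaves r)           ≤⟨ ω-+-≤ (leaves l) (leaves r) ⟩
  ω (leaves l) + ω (leaves r)       ≤⟨ +-mono-≤ (ω-leaves-≤ l) (ω-leaves-≤ r) ⟩
  suc (dnodes l) + suc (dnodes r)   ≡⟨ cong suc (+-suc (dnodes l) (dnodes r)) ⟩
  suc (suc (dnodes l + dnodes r))   ≡⟨ cong suc (sym (dnodes-D l r neq)) ⟩
  suc (dnodes (node l r))           ∎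
  where open ≤-Reasoning

Tight : Tree → Set
Tight t = ω (leaves t) ≡ suc (dnodes t)

tight⇒IsMinD : ∀ {n} x → leaves x ≡ n → Tight x → IsMinD n x
tight⇒IsMinD x lx≡n tight = lx≡n , λ t lt≡n → ≤-pred (begin
  suc (dnodes x)   ≡⟨ sym tight ⟩
  ω (leaves x)     ≡⟨ cong ω (trans lx≡n (sym lt≡n)) ⟩
  ω (leaves t)     ≤⟨ ω-leaves-≤ t ⟩
  suc (dnodes t)   ∎)
  where open ≤-Reasoning

IsMinD⇒tight : ∀ {n} x t → leaves x ≡ n → Tight x → IsMinD n t → Tight t
IsMinD⇒tight x t lx≡n tight (lt≡n , minimal) = ≤-antisym (ω-leaves-≤ t) (begin
  suc (dnodes t)   ≤⟨ s≤s (minimal x lx≡n) ⟩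
  suc (dnodes x)   ≡⟨ sym tight ⟩
  ω (leaves x)     ≡⟨ cong ω (trans lx≡n (sym lt≡n)) ⟩
  ω (leaves t)     ∎)
  where open ≤-Reasoning

tight-S : ∀ l r → leaves l ≡ leaves r → Tight (node l r) → ω (leaves l) ≡ 1 × Tight l × Tight r
tight-S l r eq tight = ωl≡1 , trans ωl≡1 (cong suc (sym dl≡0)) , trans ωr≡1 (cong suc (sym dr≡0))
  where
  ωl≡1+dl+dr : ω (leaves l) ≡ suc (dnodes l + dnodes r)
  ωl≡1+dl+dr = begin
    ω (leaves l)                ≡⟨ sym (ω-even (leaves l)) ⟩
    ω (leaves l + leaves l)     ≡⟨ cong (λ b → ω (leaves l + b)) eq ⟩
    ω (leaves l + leaves r)     ≡⟨ tight ⟩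
    suc (dnodes (node l r))     ≡⟨ cong suc (dnodes-S l r eq) ⟩
    suc (dnodes l + dnodes r)   ∎
    where open ≡-Reasoning
  ωr≡1+dr+dl : ω (leaves r) ≡ suc (dnodes r + dnodes l)
  ωr≡1+dr+dl = trans (cong ω (sym eq)) (trans ωl≡1+dl+dr (cong suc (+-comm (dnodes l) (dnodes r))))
  dr≡0 : dnodes r ≡ 0
  dr≡0 = m+n≤m⇒n≡0 (dnodes l) (≤-pred (subst (_≤ suc (dnodes l)) ωl≡1+dl+dr (ω-leaves-≤ l)))
  dl≡0 : dnodes l ≡ 0
  dl≡0 = m+n≤m⇒n≡0 (dnodes r) (≤-pred (subst (_≤ suc (dnodes r)) ωr≡1+dr+dl (ω-leaves-≤ r)))
  ωl≡1 : ω (leaves l) ≡ 1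
  ωl≡1 = trans ωl≡1+dl+dr (cong₂ (λ a b → suc (a + b)) dl≡0 dr≡0)
  ωr≡1 : ω (leaves r) ≡ 1
  ωr≡1 = trans (cong ω (sym eq)) ωl≡1

tight-D : ∀ l r → leaves l ≢ leaves r → Tight (node l r) →
          Tight l × Tight r × CarryFree (leaves l) (leaves r)
tight-D l r neq tight = tl , tr , trans tight (trans 1+d≡ (sym (cong₂ _+_ tl tr)))
  where
  1+d≡ : suc (dnodes (node l r)) ≡ suc (dnodes l) + suc (dnodes r)
  1+d≡ = trans (cong suc (dnodes-D l r neq)) (cong suc (sym (+-suc (dnodes l) (dnodes r))))
  squeezed : Tight l × Tight r
  squeezed = +-≤-squeeze (ω-leaves-≤ l) (ω-leaves-≤ r) (begin
    suc (dnodes l) + suc (dnodes r)   ≡⟨ sym 1+d≡ ⟩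
    suc (dnodes (node l r))           ≡⟨ sym tight ⟩
    ω (leaves l + leaves r)           ≤⟨ ω-+-≤ (leaves l) (leaves r) ⟩
    ω (leaves l) + ω (leaves r)       ∎)
    where open ≤-Reasoning
  tl : Tight l
  tl = proj₁ squeezed
  tr : Tight r
  tr = proj₂ squeezed

tight-double : ∀ {t} → Tight t → Tight (double t)
tight-double {t} tight = begin
  ω (leaves (double t))     ≡⟨ cong ω (leaves-double t) ⟩
  ω (leaves t + leaves t)   ≡⟨ ω-even (leaves t) ⟩
  ω (leaves t)              ≡⟨ tight ⟩
  suc (dnodes t)            ≡⟨ cong suc (sym (dnodes-double t)) ⟩
  suc (dnodes (double t))   ∎
  where open ≡-Reasoning

-- Canonical trees

data Perfect : Tree → Set where
  leaf : Perfect leaf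
  node : ∀ {p} → Perfect p → Perfect (node p p)

dnodes-perfect : ∀ {p} → Perfect p → dnodes p ≡ 0
dnodes-perfect leaf             = refl
dnodes-perfect (node {p} perf) = trans (dnodes-S p p refl) (cong₂ _+_ d≡0 d≡0)
  where
  d≡0 : dnodes p ≡ 0
  d≡0 = dnodes-perfect perf

double-perfect : ∀ {p} → Perfect p → double p ≡ node p p
double-perfect leaf        = refl
double-perfect (node perf) = cong (λ q → node q q) (double-perfect perf)

perfect-double : ∀ {p} → Perfect p → Perfect (double p)
perfect-double leaf        = node leaf
perfect-double (node perf) = node (perfect-double perf)

perfect-unique : ∀ {p q} → Perfect p → Perfect q → leaves p ≡ leaves q → p ≡ q
perfect-unique leaf leaf _ = refl
perfect-unique leaf (node {q} _) 1≡2q = contradiction 1≡2q (odd≢even 0 (leaves q))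
perfect-unique (node {p} _) leaf 2p≡1 = contradiction (sym 2p≡1) (odd≢even 0 (leaves p))
perfect-unique (node pp) (node pq) eq = cong (λ x → node x x) (perfect-unique pp pq (double-cancel eq))

-- A normal form for tight trees up to isomorphism: at D-nodes the smaller subtree is on the
-- left, and S-nodes have perfect children, as every S-node of a tight tree does (tight-S).
data Canonical : Tree → Set where
  leaf : Canonical leaf
  same : ∀ {p} → Perfect p → Canonical (node p p)
  diff : ∀ {l r} → Canonical l → Canonical r → leaves l < leaves r → Canonical (node l r)

canonical-double : ∀ {t} → Canonical t → Canonical (double t)
canonical-double leaf = same leaf
canonical-double (same perf) = same (perfect-double perf)
canonical-double (diff {l} {r} cl cr l<r) = diff (canonical-double cl) (canonical-double cr)
  (subst₂ _<_ (sym (leaves-double l)) (sym (leaves-double r)) (+-mono-< l<r l<r))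

canonical-perfect : ∀ {t} → Canonical t → dnodes t ≡ 0 → Perfect t
canonical-perfect leaf _ = leaf
canonical-perfect (same perf) _ = node perf
canonical-perfect (diff {l} {r} _ _ l<r) d≡0 with () ← trans (sym (dnodes-D l r (<⇒≢ l<r))) d≡0

≅-leaves : ∀ {s t} → s ≅ t → leaves s ≡ leaves t
≅-leaves leaf≅ = refl
≅-leaves (keep≅ l≅l′ r≅r′) = cong₂ _+_ (≅-leaves l≅l′) (≅-leaves r≅r′)
≅-leaves (swap≅ {r′ = r′} l≅r′ r≅l′) =
  trans (cong₂ _+_ (≅-leaves l≅r′) (≅-leaves r≅l′)) (+-comm (leaves r′) _)

≅-sym : ∀ {s t} → s ≅ t → t ≅ s
≅-sym leaf≅                = leaf≅
≅-sym (keep≅ l≅l′ r≅r′)   = keep≅ (≅-sym l≅l′) (≅-sym r≅r′)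
≅-sym (swap≅ l≅r′ r≅l′)   = swap≅ (≅-sym r≅l′) (≅-sym l≅r′)

≅-balanced : ∀ {p l r} → node p p ≅ node l r → leaves l ≡ leaves r
≅-balanced (keep≅ p≅l p≅r) = trans (sym (≅-leaves p≅l)) (≅-leaves p≅r)
≅-balanced (swap≅ p≅r p≅l) = trans (sym (≅-leaves p≅l)) (≅-leaves p≅r)

canonical-≅⇒≡ : ∀ {s t} → Canonical s → Canonical t → s ≅ t → s ≡ t
canonical-≅⇒≡ leaf leaf leaf≅ = refl
canonical-≅⇒≡ (same pp) (same pq) (keep≅ p≅q _) =
  cong (λ x → node x x) (perfect-unique pp pq (≅-leaves p≅q))
canonical-≅⇒≡ (same pp) (same pq) (swap≅ p≅q _) =
  cong (λ x → node x x) (perfect-unique pp pq (≅-leaves p≅q))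
canonical-≅⇒≡ (diff cl cr _) (diff cl′ cr′ _) (keep≅ l≅l′ r≅r′) =
  cong₂ node (canonical-≅⇒≡ cl cl′ l≅l′) (canonical-≅⇒≡ cr cr′ r≅r′)
canonical-≅⇒≡ (diff _ _ l<r) (diff _ _ l′<r′) (swap≅ l≅r′ r≅l′) =
  contradiction (subst₂ _<_ (≅-leaves l≅r′) (≅-leaves r≅l′) l<r) (<-asym l′<r′)
canonical-≅⇒≡ (same _) (diff _ _ l<r) p≅lr = contradiction (≅-balanced p≅lr) (<⇒≢ l<r)
canonical-≅⇒≡ (diff _ _ l<r) (same _) lr≅p = contradiction (≅-balanced (≅-sym lr≅p)) (<⇒≢ l<r)

-- Grafting a new leaf

-- The trees obtained from double t by giving a new leaf as sibling to a subtree all of whose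
-- proper ancestors are D-nodes. A canonical tree with d D-nodes has 2d + 1 of them (length-graft).
mutual
  graft : Tree → List Tree
  graft t = node leaf (double t) ∷ graft-below t

  graft-below : Tree → List Tree
  graft-below leaf = []
  graft-below (node l r) with leaves l ≟ leaves r
  ... | yes _ = []
  ... | no _  = map (λ l′ → node l′ (double r)) (graft l) ++ map (node (double l)) (graft r)

data Grafting : Tree → Tree → Set where
  root  : ∀ {t} → Grafting t (node leaf (double t))
  left  : ∀ {l r y} → leaves l ≢ leaves r → Grafting l y → Grafting (node l r) (node y (double r))
  right : ∀ {l r z} → leaves l ≢ leaves r → Grafting r z → Grafting (node l r) (node (double l) z)

∈-graft⁻ : ∀ t {y} → y ∈ graft t → Grafting t y
∈-graft⁻ t          (here refl) = root
∈-graft⁻ (node l r) (there y∈)  with leaves l ≟ leaves r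
... | no neq with ∈-++⁻ (map (λ l′ → node l′ (double r)) (graft l)) y∈
...   | inj₁ y∈ˡ with l′ , l′∈ , refl ← ∈-map⁻ (λ l′ → node l′ (double r)) y∈ˡ =
  left neq (∈-graft⁻ l l′∈)
...   | inj₂ y∈ʳ with r′ , r′∈ , refl ← ∈-map⁻ (node (double l)) y∈ʳ =
  right neq (∈-graft⁻ r r′∈)

∈-graft⁺ : ∀ {t y} → Grafting t y → y ∈ graft t
∈-graft⁺ root = here refl
∈-graft⁺ (left {l} {r} neq g) with leaves l ≟ leaves r
... | yes eq = contradiction eq neq
... | no _   = there (∈-++⁺ˡ (∈-map⁺ (λ l′ → node l′ (double r)) (∈-graft⁺ g)))
∈-graft⁺ (right {l} {r} neq g) with leaves l ≟ leaves r
... | yes eq = contradiction eq neq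
... | no _   =
  there (∈-++⁺ʳ (map (λ l′ → node l′ (double r)) (graft l)) (∈-map⁺ (node (double l)) (∈-graft⁺ g)))

grafting-leaves : ∀ {t y} → Grafting t y → leaves y ≡ suc (leaves t + leaves t)
grafting-leaves {t} root = cong suc (leaves-double t)
grafting-leaves (left {l} {r} {y} _ g) = begin
  leaves y + leaves (double r)                 ≡⟨ cong₂ _+_ (grafting-leaves g) (leaves-double r) ⟩
  suc (leaves l + leaves l) + (leaves r + leaves r) ≡⟨ cong suc (double-+ (leaves l) (leaves r)) ⟩
  suc ((leaves l + leaves r) + (leaves l + leaves r)) ∎
  where open ≡-Reasoning
grafting-leaves (right {l} {r} {z} _ g) = begin
  leaves (double l) + leaves z                 ≡⟨ cong₂ _+_ (leaves-double l) (grafting-leaves g) ⟩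
  (leaves l + leaves l) + suc (leaves r + leaves r) ≡⟨ +-suc (leaves l + leaves l) _ ⟩
  suc ((leaves l + leaves l) + (leaves r + leaves r)) ≡⟨ cong suc (double-+ (leaves l) (leaves r)) ⟩
  suc ((leaves l + leaves r) + (leaves l + leaves r)) ∎
  where open ≡-Reasoning

leaf≢double : ∀ t → leaves leaf ≢ leaves (double t)
leaf≢double t eq = odd≢even 0 (leaves t) (trans eq (leaves-double t))

grafting≢double : ∀ {s y} t → Grafting s y → leaves y ≢ leaves (double t)
grafting≢double {s} t g eq =
  odd≢even (leaves s) (leaves t) (trans (sym (grafting-leaves g)) (trans eq (leaves-double t)))

grafting≢leaf : ∀ {t y} → Grafting t y → y ≢ leaf
grafting≢leaf root        ()
grafting≢leaf (left _ _)  ()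
grafting≢leaf (right _ _) ()

grafting-dnodes : ∀ {t y} → Grafting t y → dnodes y ≡ suc (dnodes t)
grafting-dnodes {t} root = trans (dnodes-D leaf (double t) (leaf≢double t)) (cong suc (dnodes-double t))
grafting-dnodes (left {l} {r} {y} neq g) = begin
  dnodes (node y (double r))              ≡⟨ dnodes-D y (double r) (grafting≢double r g) ⟩
  suc (dnodes y + dnodes (double r))      ≡⟨ cong suc (cong₂ _+_ (grafting-dnodes g) (dnodes-double r)) ⟩
  suc (suc (dnodes l + dnodes r))         ≡⟨ cong suc (sym (dnodes-D l r neq)) ⟩
  suc (dnodes (node l r))                 ∎
  where open ≡-Reasoning
grafting-dnodes (right {l} {r} {z} neq g) = begin
  dnodes (node (double l) z)              ≡⟨ dnodes-D (double l) z (grafting≢double l g ∘ sym) ⟩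
  suc (dnodes (double l) + dnodes z)      ≡⟨ cong suc (cong₂ _+_ (dnodes-double l) (grafting-dnodes g)) ⟩
  suc (dnodes l + suc (dnodes r))         ≡⟨ cong suc (+-suc (dnodes l) (dnodes r)) ⟩
  suc (suc (dnodes l + dnodes r))         ≡⟨ cong suc (sym (dnodes-D l r neq)) ⟩
  suc (dnodes (node l r))                 ∎
  where open ≡-Reasoning

tight-grafting : ∀ {t y} → Tight t → Grafting t y → Tight y
tight-grafting {t} {y} tight g = begin
  ω (leaves y)                    ≡⟨ cong ω (grafting-leaves g) ⟩
  ω (suc (leaves t + leaves t))   ≡⟨ ω-odd (leaves t) ⟩
  suc (ω (leaves t))              ≡⟨ cong suc tight ⟩
  suc (suc (dnodes t))            ≡⟨ cong suc (sym (grafting-dnodes g)) ⟩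
  suc (dnodes y)                  ∎
  where open ≡-Reasoning

grafting-canonical : ∀ {t y} → Canonical t → Grafting t y → Canonical y
grafting-canonical {t} c root = diff leaf (canonical-double c)
  (subst (1 <_) (sym (leaves-double t)) (+-mono-≤ (1≤leaves t) (1≤leaves t)))
grafting-canonical (same _)   (left neq _)  = contradiction refl neq
grafting-canonical (same _)   (right neq _) = contradiction refl neq
grafting-canonical (diff {l} {r} cl cr l<r) (left {y = y} _ g) =
  diff (grafting-canonical cl g) (canonical-double cr) (begin-strict
    leaves y                  ≡⟨ grafting-leaves g ⟩
    suc (leaves l + leaves l)       <⟨ n<1+n _ ⟩
    suc (suc (leaves l + leaves l)) ≡⟨ cong suc (sym (+-suc (leaves l) (leaves l))) ⟩
    suc (leaves l) + suc (leaves l) ≤⟨ +-mono-≤ l<r l<r ⟩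
    leaves r + leaves r       ≡⟨ sym (leaves-double r) ⟩
    leaves (double r)         ∎)
  where open ≤-Reasoning
grafting-canonical (diff {l} {r} cl cr l<r) (right {z = z} _ g) =
  diff (canonical-double cl) (grafting-canonical cr g) (begin-strict
    leaves (double l)         ≡⟨ leaves-double l ⟩
    leaves l + leaves l       ≤⟨ +-mono-≤ (<⇒≤ l<r) (<⇒≤ l<r) ⟩
    leaves r + leaves r       <⟨ n<1+n _ ⟩
    suc (leaves r + leaves r) ≡⟨ sym (grafting-leaves g) ⟩
    leaves z                  ∎)
  where open ≤-Reasoning

grafting-injective : ∀ {s t y y′} → Grafting s y → Grafting t y′ → y ≡ y′ → s ≡ t
grafting-injective root root eq = double-injective (cong rightChild eq)
grafting-injective root (left _ g) eq = contradiction (sym (cong leftChild eq)) (grafting≢leaf g)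
grafting-injective root (right {l} _ _) eq = contradiction (sym (cong leftChild eq)) (double≢leaf l)
grafting-injective (left _ g) root eq = contradiction (cong leftChild eq) (grafting≢leaf g)
grafting-injective (right {l} _ _) root eq = contradiction (cong leftChild eq) (double≢leaf l)
grafting-injective (left _ g) (left _ g′) eq =
  cong₂ node (grafting-injective g g′ (cong leftChild eq)) (double-injective (cong rightChild eq))
grafting-injective (right _ g) (right _ g′) eq =
  cong₂ node (double-injective (cong leftChild eq)) (grafting-injective g g′ (cong rightChild eq))
grafting-injective (left _ g) (right {l} _ _) eq =
  contradiction (cong (leaves ∘ leftChild) eq) (grafting≢double l g)
grafting-injective (right {l} _ _) (left _ g) eq =
  contradiction (cong (leaves ∘ leftChild) (sym eq)) (grafting≢double l g)

graft-unique : ∀ t → Unique (graft t)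
graft-unique leaf = [] ∷ []
graft-unique (node l r) with leaves l ≟ leaves r
... | yes _ = [] ∷ []
... | no _  = All.tabulate root∉below
              ∷ Unique.++⁺ (Unique.map⁺ (cong leftChild) (graft-unique l))
                           (Unique.map⁺ (cong rightChild) (graft-unique r)) disjoint
  where
  graftsˡ graftsʳ : List Tree
  graftsˡ = map (λ l′ → node l′ (double r)) (graft l)
  graftsʳ = map (node (double l)) (graft r)
  root∉below : ∀ {y} → y ∈ graftsˡ ++ graftsʳ → node leaf (double (node l r)) ≢ y
  root∉below y∈ eq with ∈-++⁻ graftsˡ y∈
  ... | inj₁ y∈ˡ with l′ , l′∈ , refl ← ∈-map⁻ (λ l′ → node l′ (double r)) y∈ˡ =
    grafting≢leaf (∈-graft⁻ l l′∈) (sym (cong leftChild eq))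
  ... | inj₂ y∈ʳ with _ , _ , refl ← ∈-map⁻ (node (double l)) y∈ʳ =
    double≢leaf l (sym (cong leftChild eq))
  disjoint : ∀ {y} → ¬ (y ∈ graftsˡ × y ∈ graftsʳ)
  disjoint (y∈ˡ , y∈ʳ) with l′ , l′∈ , refl ← ∈-map⁻ (λ l′ → node l′ (double r)) y∈ˡ
                          | _ , _ , eq ← ∈-map⁻ (node (double l)) y∈ʳ =
    grafting≢double l (∈-graft⁻ l l′∈) (cong (leaves ∘ leftChild) eq)

length-graft : ∀ {t} → Canonical t → length (graft t) ≡ suc (2 * dnodes t)
length-graft leaf = refl
length-graft (same {p} perf) with leaves p ≟ leaves p
... | yes _  = cong (λ d → suc (2 * d)) (sym (dnodes-perfect (node perf)))
... | no neq = contradiction refl neq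
length-graft (diff {l} {r} cl cr l<r) with leaves l ≟ leaves r
... | yes eq = contradiction eq (<⇒≢ l<r)
... | no neq = cong suc (begin
  length (map (λ l′ → node l′ (double r)) (graft l) ++ map (node (double l)) (graft r))
    ≡⟨ length-++ (map (λ l′ → node l′ (double r)) (graft l)) ⟩
  length (map (λ l′ → node l′ (double r)) (graft l)) + length (map (node (double l)) (graft r))
    ≡⟨ cong₂ _+_ (length-map _ (graft l)) (length-map _ (graft r)) ⟩
  length (graft l) + length (graft r)
    ≡⟨ cong₂ _+_ (length-graft cl) (length-graft cr) ⟩
  suc (2 * dnodes l) + suc (2 * dnodes r)
    ≡⟨ solve 2 (λ a b → (con 1 :+ con 2 :* a) :+ (con 1 :+ con 2 :* b) := con 2 :* (con 1 :+ (a :+ b)))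
               refl (dnodes l) (dnodes r) ⟩
  2 * suc (dnodes l + dnodes r)
    ≡⟨ cong (2 *_) (sym (dnodes-D l r neq)) ⟩
  2 * dnodes (node l r) ∎)
  where open ≡-Reasoning

-- Generating the canonical tight trees

fromHalf : Parity → List Tree → List Tree
fromHalf 0ℙ = map double
fromHalf 1ℙ = concatMap graft

-- Fuel-bounded like popcount′: minDTrees (m + m) = map double (minDTrees m) and, for m ≥ 1,
-- minDTrees (1 + m + m) = concatMap graft (minDTrees m).
generate : ℕ → ℕ → List Tree
generate zero    _             = []
generate (suc f) zero          = []
generate (suc f) (suc zero)    = leaf ∷ []
generate (suc f) (suc (suc n)) = fromHalf (parity n) (generate f (suc ⌊ n /2⌋))

minDTrees : ℕ → List Tree
minDTrees n = generate n n

generate-fuel : ∀ f g n → n ≤ f → n ≤ g → generate f n ≡ generate g n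
generate-fuel zero    zero    _ _ _ = refl
generate-fuel zero    (suc _) zero _ _ = refl
generate-fuel (suc _) zero    zero _ _ = refl
generate-fuel (suc _) (suc _) zero _ _ = refl
generate-fuel (suc _) (suc _) (suc zero) _ _ = refl
generate-fuel (suc f) (suc g) (suc (suc n)) (s≤s n<f) (s≤s n<g) =
  cong (fromHalf (parity n)) (generate-fuel f g (suc ⌊ n /2⌋) (half< n<f) (half< n<g))
  where
  half< : ∀ {k} → suc n ≤ k → suc ⌊ n /2⌋ ≤ k
  half< = ≤-trans (s≤s (⌊n/2⌋≤n n))

minDTrees-even : ∀ m → minDTrees (m + m) ≡ map double (minDTrees m)
minDTrees-even zero = refl
minDTrees-even (suc m) rewrite +-suc m m | parity-even m | sym (n≡⌊n+n/2⌋ m) =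
  cong (map double) (generate-fuel (suc (m + m)) (suc m) (suc m) (s≤s (m≤n+m m m)) ≤-refl)

minDTrees-odd : ∀ m → 1 ≤ m → minDTrees (suc (m + m)) ≡ concatMap graft (minDTrees m)
minDTrees-odd (suc m) _ rewrite +-suc m m | parity-odd m | sym (n≡⌈n+n/2⌉ m) =
  cong (concatMap graft)
    (generate-fuel (suc (suc (m + m))) (suc m) (suc m) (s≤s (m≤n+m m (suc m))) ≤-refl)

∈-minDTrees-even⁺ : ∀ {m y} → y ∈ minDTrees m → double y ∈ minDTrees (m + m)
∈-minDTrees-even⁺ {m} y∈ = subst (_ ∈_) (sym (minDTrees-even m)) (∈-map⁺ double y∈)

∈-minDTrees-even⁻ : ∀ {m y} → y ∈ minDTrees (m + m) →
                    ∃ λ y′ → y′ ∈ minDTrees m × y ≡ double y′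
∈-minDTrees-even⁻ {m} y∈ = ∈-map⁻ double (subst (_ ∈_) (minDTrees-even m) y∈)

∈-minDTrees-odd⁺ : ∀ {m y′ y} → 1 ≤ m → y′ ∈ minDTrees m → Grafting y′ y →
                   y ∈ minDTrees (suc (m + m))
∈-minDTrees-odd⁺ {m} 1≤m y′∈ g =
  subst (_ ∈_) (sym (minDTrees-odd m 1≤m)) (Any.concatMap⁺ graft (lose y′∈ (∈-graft⁺ g)))

∈-minDTrees-odd⁻ : ∀ {m y} → 1 ≤ m → y ∈ minDTrees (suc (m + m)) →
                   ∃ λ y′ → y′ ∈ minDTrees m × Grafting y′ y
∈-minDTrees-odd⁻ {m} 1≤m y∈
  with y′ , y′∈ , y∈graft ← find (Any.concatMap⁻ graft (subst (_ ∈_) (minDTrees-odd m 1≤m) y∈)) =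
  y′ , y′∈ , ∈-graft⁻ y′ y∈graft

MinDRepresentative : ℕ → Tree → Set
MinDRepresentative n x = leaves x ≡ n × Tight x × Canonical x

∈-minDTrees⁻ : ∀ n {x} → x ∈ minDTrees n → MinDRepresentative n x
∈-minDTrees⁻ = binary-ind AllRepresentatives (λ ()) even-case odd-case
  where
  AllRepresentatives : ℕ → Set
  AllRepresentatives n = ∀ {x} → x ∈ minDTrees n → MinDRepresentative n x
  even-case : ∀ m → AllRepresentatives m → AllRepresentatives (m + m)
  even-case m ih x∈ with x′ , x′∈ , refl ← ∈-minDTrees-even⁻ {m} x∈ | ih x′∈
  ... | l≡m , tight , c =
    trans (leaves-double x′) (cong₂ _+_ l≡m l≡m) , tight-double {x′} tight , canonical-double c
  odd-case : ∀ m → AllRepresentatives m → AllRepresentatives (suc (m + m))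
  odd-case zero    _  (here refl) = refl , refl , leaf
  odd-case (suc m) ih x∈ with x′ , x′∈ , g ← ∈-minDTrees-odd⁻ {suc m} (s≤s z≤n) x∈ | ih x′∈
  ... | l≡m , tight , c =
    trans (grafting-leaves g) (cong (λ k → suc (k + k)) l≡m) , tight-grafting tight g , grafting-canonical c g

∈-minDTrees-perfect : ∀ {a x} → x ∈ minDTrees a → ω a ≡ 1 → Perfect x
∈-minDTrees-perfect {a} x∈ ωa≡1 with l≡a , tight , c ← ∈-minDTrees⁻ a x∈ =
  canonical-perfect c (suc-injective (trans (sym tight) (trans (cong ω l≡a) ωa≡1)))

concatMap-graft-unique : ∀ {xs} → Unique xs → Unique (concatMap graft xs)
concatMap-graft-unique {xs} xs! =
  Unique.concat⁺ (All.map⁺ (All.universal graft-unique xs)) (AllPairs.map⁺ (AllPairs.map disjoint xs!))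
  where
  disjoint : ∀ {x x′} → x ≢ x′ → Disjoint (graft x) (graft x′)
  disjoint {x} {x′} x≢x′ (y∈ , y∈′) =
    x≢x′ (grafting-injective (∈-graft⁻ x y∈) (∈-graft⁻ x′ y∈′) refl)

minDTrees-unique : ∀ n → Unique (minDTrees n)
minDTrees-unique = binary-ind (Unique ∘ minDTrees) [] even-case odd-case
  where
  even-case : ∀ m → Unique (minDTrees m) → Unique (minDTrees (m + m))
  even-case m ms! = subst Unique (sym (minDTrees-even m)) (Unique.map⁺ double-injective ms!)
  odd-case : ∀ m → Unique (minDTrees m) → Unique (minDTrees (suc (m + m)))
  odd-case zero    _   = [] ∷ []
  odd-case (suc m) ms! = subst Unique (sym (minDTrees-odd (suc m) (s≤s z≤n))) (concatMap-graft-unique ms!)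

length-concatMap : ∀ {A B : Set} (f : A → List B) {c} xs →
                   (∀ {x} → x ∈ xs → length (f x) ≡ c) → length (concatMap f xs) ≡ length xs * c
length-concatMap f []       _    = refl
length-concatMap f (x ∷ xs) lens =
  trans (length-++ (f x)) (cong₂ _+_ (lens (here refl)) (length-concatMap f xs (lens ∘ there)))

dfact2w-3-suc : ∀ w → dfact2w-3 (suc (suc w)) ≡ suc (2 * w) * dfact2w-3 (suc w)
dfact2w-3-suc zero = refl
dfact2w-3-suc (suc w) rewrite +-identityʳ w | +-suc w (suc (suc w)) | +-suc w (suc w) | +-suc w w = refl

length-minDTrees : ∀ n → 1 ≤ n → length (minDTrees n) ≡ dfact2w-3 (ω n)
length-minDTrees = binary-ind P (λ ()) even-case odd-case
  where
  P : ℕ → Set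
  P n = 1 ≤ n → length (minDTrees n) ≡ dfact2w-3 (ω n)
  even-case : ∀ m → P m → P (m + m)
  even-case zero    _  ()
  even-case (suc m) ih _ = begin
    length (minDTrees (suc m + suc m))          ≡⟨ cong length (minDTrees-even (suc m)) ⟩
    length (map double (minDTrees (suc m)))     ≡⟨ length-map double (minDTrees (suc m)) ⟩
    length (minDTrees (suc m))                  ≡⟨ ih (s≤s z≤n) ⟩
    dfact2w-3 (ω (suc m))                       ≡⟨ cong dfact2w-3 (sym (ω-even (suc m))) ⟩
    dfact2w-3 (ω (suc m + suc m))               ∎
    where open ≡-Reasoning
  odd-case : ∀ m → P m → P (suc (m + m))
  odd-case zero    _  _ = refl
  odd-case (suc m) ih _ with ω (suc m) in ωm≡ | ω-positive (suc m) (s≤s z≤n)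
  ... | suc w | _ = begin
    length (minDTrees (suc (suc m + suc m)))       ≡⟨ cong length (minDTrees-odd (suc m) (s≤s z≤n)) ⟩
    length (concatMap graft (minDTrees (suc m)))   ≡⟨ length-concatMap graft _ length-grafts ⟩
    length (minDTrees (suc m)) * suc (2 * w)       ≡⟨ cong (_* suc (2 * w)) (ih (s≤s z≤n)) ⟩
    dfact2w-3 (suc w) * suc (2 * w)                ≡⟨ *-comm (dfact2w-3 (suc w)) _ ⟩
    suc (2 * w) * dfact2w-3 (suc w)                ≡⟨ sym (dfact2w-3-suc w) ⟩
    dfact2w-3 (suc (suc w))                        ≡⟨ cong dfact2w-3 (sym (trans (ω-odd (suc m)) (cong suc ωm≡))) ⟩
    dfact2w-3 (ω (suc (suc m + suc m)))            ∎
    where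
    open ≡-Reasoning
    length-grafts : ∀ {x} → x ∈ minDTrees (suc m) → length (graft x) ≡ suc (2 * w)
    length-grafts x∈ with l≡ , tight , c ← ∈-minDTrees⁻ (suc m) x∈ =
      trans (length-graft c)
        (cong (λ d → suc (2 * d)) (suc-injective (trans (sym tight) (trans (cong ω l≡) ωm≡))))

!!-positive : ∀ m → 1 ≤ m !!
!!-positive zero          = ≤-refl
!!-positive (suc zero)    = ≤-refl
!!-positive (suc (suc m)) = *-mono-≤ {1} {suc (suc m)} (s≤s z≤n) (!!-positive m)

dfact2w-3-positive : ∀ w → 1 ≤ dfact2w-3 w
dfact2w-3-positive zero          = ≤-refl
dfact2w-3-positive (suc zero)    = ≤-refl
dfact2w-3-positive (suc (suc w)) = !!-positive (2 * suc (suc w) ∸ 3)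

-- Every tight tree is represented

Merges : ℕ → Set
Merges a = ∀ b → 1 ≤ a → a < b → CarryFree a b →
           ∀ {y z} → y ∈ minDTrees a → z ∈ minDTrees b → node y z ∈ minDTrees (a + b)

minDTrees-leaves-≢ : ∀ {a b y z} → y ∈ minDTrees a → z ∈ minDTrees b → a ≢ b → leaves y ≢ leaves z
minDTrees-leaves-≢ {a} {b} y∈ z∈ a≢b eq =
  a≢b (trans (sym (proj₁ (∈-minDTrees⁻ a y∈))) (trans eq (proj₁ (∈-minDTrees⁻ b z∈))))

-- As a and b add without carry they are not both odd, so either both trees are doubles, or
-- exactly one arises by grafting and its new leaf is grafted at the same place in the merged tree.
merge-even : ∀ x → Merges x → Merges (x + x)
merge-even zero _ _ ()
merge-even x@(suc _) ih b _ 2x<b cf {z = z} y∈ z∈ with halving b | ∈-minDTrees-even⁻ {x} y∈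
... | even w | y′ , y′∈ , refl with z′ , z′∈ , refl ← ∈-minDTrees-even⁻ {w} z∈ =
  subst (_ ∈_) (cong minDTrees (sym (double-+ x w)))
    (∈-minDTrees-even⁺ {x + w}
      (ih w (s≤s z≤n) (double-<⁻ 2x<b) (carryFree-even-even {x} cf) y′∈ z′∈))
... | odd w | y′ , y′∈ , refl = grafted (∈-minDTrees-odd⁻ {w} 1≤w z∈)
  where
  cf′ : CarryFree x w
  cf′ = carryFree-even-odd {x} {w} cf
  x<w : x < w
  x<w = ≤∧≢⇒< (double-≤⁻ (≤-pred 2x<b))
              (λ x≡w → ¬carryFree-self x (s≤s z≤n) (subst (CarryFree x) (sym x≡w) cf′))
  1≤w : 1 ≤ w
  1≤w = ≤-trans (s≤s z≤n) x<w
  grafted : (∃ λ z′ → z′ ∈ minDTrees w × Grafting z′ z) →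
            node (double y′) z ∈ minDTrees (x + x + suc (w + w))
  grafted (z′ , z′∈ , g) =
    subst (_ ∈_) (cong minDTrees (sym (trans (+-suc (x + x) (w + w)) (cong suc (double-+ x w)))))
      (∈-minDTrees-odd⁺ (≤-trans (s≤s z≤n) (m≤m+n x w))
        (ih w (s≤s z≤n) x<w cf′ y′∈ z′∈)
        (right (minDTrees-leaves-≢ y′∈ z′∈ (<⇒≢ x<w)) g))

merge-odd : ∀ x → Merges x → Merges (suc (x + x))
merge-odd zero _ b _ 1<b cf (here refl) z∈ with halving b
... | odd w = contradiction cf (¬carryFree-odd-odd 0 w)
... | even w with z′ , z′∈ , refl ← ∈-minDTrees-even⁻ {w} z∈ =
  ∈-minDTrees-odd⁺ {w} (double-≤⁻ 1<b) z′∈ root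
merge-odd x@(suc _) ih b _ 2x+1<b cf y∈ z∈ with halving b
... | odd w = contradiction cf (¬carryFree-odd-odd x w)
... | even w with z′ , z′∈ , refl ← ∈-minDTrees-even⁻ {w} z∈
               | y′ , y′∈ , g ← ∈-minDTrees-odd⁻ {x} (s≤s z≤n) y∈ =
  subst (_ ∈_) (cong (minDTrees ∘ suc) (sym (double-+ x w)))
    (∈-minDTrees-odd⁺ (≤-trans (s≤s z≤n) (m≤m+n x w))
      (ih w (s≤s z≤n) x<w (carryFree-odd-even {x} cf) y′∈ z′∈)
      (left (minDTrees-leaves-≢ y′∈ z′∈ (<⇒≢ x<w)) g))
  where
  x<w : x < w
  x<w = double-<⁻ (<-trans (n<1+n _) 2x+1<b)

merge : ∀ a → Merges a
merge = binary-ind Merges (λ _ ()) merge-even merge-odd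

tight⇒∃≅ : ∀ t → Tight t → ∃ λ x → x ∈ minDTrees (leaves t) × t ≅ x
tight⇒∃≅ leaf _ = leaf , here refl , leaf≅
tight⇒∃≅ (node l r) tight with leaves l ≟ leaves r
... | yes eq with ωl≡1 , tl , tr ← tight-S l r eq tight
    with y , y∈ , l≅y ← tight⇒∃≅ l tl | z , z∈ , r≅z ← tight⇒∃≅ r tr =
  node y y ,
  subst (λ b → node y y ∈ minDTrees (leaves l + b)) eq
    (subst (_∈ minDTrees (leaves l + leaves l)) (double-perfect py) (∈-minDTrees-even⁺ {leaves l} y∈)) ,
  keep≅ l≅y (subst (r ≅_) (sym y≡z) r≅z)
  where
  py : Perfect y
  py = ∈-minDTrees-perfect {leaves l} y∈ ωl≡1
  y≡z : y ≡ z
  y≡z = perfect-unique py (∈-minDTrees-perfect {leaves r} z∈ (trans (cong ω (sym eq)) ωl≡1))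
          (trans (proj₁ (∈-minDTrees⁻ _ y∈)) (trans eq (sym (proj₁ (∈-minDTrees⁻ _ z∈)))))
... | no neq with tl , tr , cf ← tight-D l r neq tight
    with y , y∈ , l≅y ← tight⇒∃≅ l tl | z , z∈ , r≅z ← tight⇒∃≅ r tr
       | <-cmp (leaves l) (leaves r)
... | tri< l<r _ _ =
  node y z , merge (leaves l) (leaves r) (1≤leaves l) l<r cf y∈ z∈ , keep≅ l≅y r≅z
... | tri≈ _ l≡r _ = contradiction l≡r neq
... | tri> _ _ r<l = node z y ,
  subst (λ n → node z y ∈ minDTrees n) (+-comm (leaves r) (leaves l))
    (merge (leaves r) (leaves l) (1≤leaves r) r<l (carryFree-sym {leaves l} cf) z∈ y∈) ,
  swap≅ l≅y r≅z

canonical-unique⇒non-isomorphic : ∀ {xs} → All Canonical xs → Unique xs →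
                                  AllPairs (λ s t → ¬ s ≅ t) xs
canonical-unique⇒non-isomorphic []       []          = []
canonical-unique⇒non-isomorphic (c ∷ cs) (x∉ ∷ xs!) =
  All.zipWith (λ (x≢y , cy) x≅y → x≢y (canonical-≅⇒≡ c cy x≅y)) (x∉ , cs)
  ∷ canonical-unique⇒non-isomorphic cs xs!

nonempty⇒∃∈ : ∀ {A : Set} {xs : List A} → 1 ≤ length xs → ∃ λ x → x ∈ xs
nonempty⇒∃∈ {xs = x ∷ _} _ = x , here refl

minDTrees-nonempty : ∀ n → 1 ≤ n → ∃ λ x → x ∈ minDTrees n
minDTrees-nonempty n 1≤n =
  nonempty⇒∃∈ (subst (1 ≤_) (sym (length-minDTrees n 1≤n)) (dfact2w-3-positive (ω n)))

corollary81 : (n : ℕ) → n ≥ 1 → NumClasses (IsMinD n) (dfact2w-3 (ω n))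
corollary81 n 1≤n =
  minDTrees n ,
  length-minDTrees n 1≤n ,
  All.tabulate minD ,
  canonical-unique⇒non-isomorphic (All.tabulate (proj₂ ∘ proj₂ ∘ ∈-minDTrees⁻ n)) (minDTrees-unique n) ,
  covered
  where
  minD : ∀ {x} → x ∈ minDTrees n → IsMinD n x
  minD {x} x∈ = let lx≡n , tight , _ = ∈-minDTrees⁻ n x∈ in tight⇒IsMinD x lx≡n tight
  covered : ∀ t → IsMinD n t → Any (t ≅_) (minDTrees n)
  covered t minD
    with x₀ , x₀∈ ← minDTrees-nonempty n 1≤n
    with lx₀≡n , tight₀ , _ ← ∈-minDTrees⁻ n x₀∈
    with x , x∈ , t≅x ← tight⇒∃≅ t (IsMinD⇒tight x₀ t lx₀≡n tight₀ minD) =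
    lose (subst (λ m → x ∈ minDTrees m) (proj₁ minD) x∈) t≅x
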